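{- Let $r\ge 3$ be an integer, $k\ge 4$ an even integer, and $G$ a $\mathcal{G}_k^{(r)}$-free $r$-graph on $n$ vertices. With $\mathcal{M}_2$ and the weights $w_F$ as in the context, for every pair $xy\in\binom{V(G)}{2}$ we have $$w(xy):=\sum_{F\in\mathcal{M}_2:\ x,y\in V(F)} w_F(xy)\le 1.$$
   Context: An $r$-graph is identified with its edge set; $|H|$ is its number of edges and $V(H)=\bigcup_{e\in H}e$. The family $\mathcal{G}_k^{(r)}$ consists of all $r$-graphs $H$ such that either $|H|=k$ and $|V(H)|\le (r-2)k+2$, or $|H|=\ell$ and $|V(H)|\le (r-2)\ell+1$ for some $\ell\in\{2,\dots,k-1\}$; $G$ is $\mathcal{G}_k^{(r)}$-free if no subset of its edges forms a member of this family. For $F\subseteq G$ and distinct vertices $x,y$, let $C_F(xy)$ be the set of integers $i\ge 0$ for which there exist $i$ distinct edges $e_1,\dots,e_i\in F$ with $|\{x,y\}\cup e_1\cup\dots\cup e_i|\le (r-2)i+2$. An $r$-graph is connected if for any edges $X,Y$ of it there are edges $X=X_1,\dots,X_m=Y$ with $|X_i\cap X_{i+1}|\ge 2$ for all $i$. $\mathcal{M}_1$ is the partition of $E(G)$ into maximal connected subgraphs. Edge-disjoint $F,H\subseteq G$ are $1|2$-mergeable if there is a pair $xy$ with $1\in C_F(xy)$ and $2\in C_H(xy)$, or $2\in C_F(xy)$ and $1\in C_H(xy)$. $\mathcal{M}_2$ is a partition of $E(G)$ obtained from $\mathcal{M}_1$ by repeatedly replacing two distinct $1|2$-mergeable parts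 by their union as long as possible. For $F\in\mathcal{M}_2$ and $xy\in\binom{V(F)}{2}$: $w_F(xy)=1$ if $1\in C_F(xy)$; $w_F(xy)=\frac{2}{k-2}$ if $2\in C_F(xy)$ and $1\notin C_F(xy)$; $w_F(xy)=0$ otherwise. -}

module Defs where

open import Data.Nat using (ℕ; zero; suc; _+_; _*_; _∸_; _≤_; _≟_; _≤?_)
open import Data.Fin using (Fin)
open import Data.Fin.Subset using (Subset; ⊥; ⁅_⁆; _∪_; _∩_; ∣_∣) renaming (_∈_ to _∈ˢ_)
open import Data.Fin.Subset.Properties using (_∈?_)
open import Data.List using (List; []; _∷_; length; map; foldr; concat; _++_)
open import Data.List.Membership.Propositional using (_∈_)
open import Data.List.Relation.Unary.Any using (Any)
import Data.List.Relation.Unary.Any as Any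
open import Data.List.Relation.Binary.Permutation.Propositional using (_↭_)
open import Data.Product using (Σ; _×_; _,_; ∃)
open import Data.Sum using (_⊎_)
open import Relation.Nullary using (¬_; Dec)
open import Relation.Nullary.Decidable using (_×-dec_; ⌊_⌋)
open import Relation.Binary.PropositionalEquality using (_≡_; _≢_)
open import Relation.Binary.Construct.Closure.ReflexiveTransitive using (Star)
open import Data.Bool using (Bool; if_then_else_; _∧_)
open import Data.Rational using (ℚ; 0ℚ; 1ℚ; _/_) renaming (_+_ to _+ℚ_)
open import Data.Integer using (+_)

Edge : ℕ → Set
Edge n = Subset n

IsRGraph : (r n : ℕ) → List (Edge n) → Set
IsRGraph r n G = Data.List.Relation.Unary.All.All (λ e → ∣ e ∣ ≡ r) G
                 × Data.List.Relation.Unary.Unique.Propositional.Unique G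
  where
  import Data.List.Relation.Unary.All
  import Data.List.Relation.Unary.Unique.Propositional

V : ∀ {n} → List (Edge n) → Subset n
V = foldr _∪_ ⊥

-- all sub-collections (sublists) of a list; for a list without
-- repetitions these are exactly the sets of distinct edges it contains
subs : ∀ {A : Set} → List A → List (List A)
subs []       = [] ∷ []
subs (a ∷ as) = subs as ++ map (a ∷_) (subs as)

GFree : (r k : ℕ) → ∀ {n} → List (Edge n) → Set
GFree r k G = ∀ H → H ∈ subs G →
    ¬ (length H ≡ k × ∣ V H ∣ ≤ (r ∸ 2) * k + 2)
  × ¬ (2 ≤ length H × suc (length H) ≤ k × ∣ V H ∣ ≤ (r ∸ 2) * length H + 1)

InC : (r : ℕ) → ∀ {n} → List (Edge n) → Fin n → Fin n → ℕ → Set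
InC r F x y i = Any (λ S → length S ≡ i × ∣ (⁅ x ⁆ ∪ ⁅ y ⁆) ∪ V S ∣ ≤ (r ∸ 2) * i + 2) (subs F)

InC? : (r : ℕ) → ∀ {n} (F : List (Edge n)) x y i → Dec (InC r F x y i)
InC? r F x y i = Any.any? (λ S → (length S ≟ i) ×-dec (∣ (⁅ x ⁆ ∪ ⁅ y ⁆) ∪ V S ∣ ≤? (r ∸ 2) * i + 2)) (subs F)

Adj : ∀ {n} → List (Edge n) → Edge n → Edge n → Set
Adj H X Y = X ∈ H × Y ∈ H × 2 ≤ ∣ X ∩ Y ∣

Connected : ∀ {n} → List (Edge n) → Set
Connected H = ∀ X Y → X ∈ H → Y ∈ H → Star (Adj H) X Y

MaximalConnected : ∀ {n} → List (Edge n) → List (Edge n) → Set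
MaximalConnected G A =
  Connected A ×
  (∀ H → (∀ e → e ∈ H → e ∈ G) → Connected H → (∀ e → e ∈ A → e ∈ H) → ∀ e → e ∈ H → e ∈ A)

-- partitions of E(G): a list of (nonempty) parts whose concatenation is a
-- permutation of G
NonEmpty : ∀ {A : Set} → List A → Set
NonEmpty []      = Data.Empty.⊥ where import Data.Empty
NonEmpty (_ ∷ _) = Data.Unit.⊤ where import Data.Unit

IsM1 : ∀ {n} → List (Edge n) → List (List (Edge n)) → Set
IsM1 G P = concat P ↭ G × (∀ A → A ∈ P → NonEmpty A × MaximalConnected G A)

Mergeable : (r : ℕ) → ∀ {n} → List (Edge n) → List (Edge n) → Set
Mergeable r F H = Σ _ λ x → Σ _ λ y → x ≢ y ×
  ((InC r F x y 1 × InC r H x y 2) ⊎ (InC r F x y 2 × InC r H x y 1))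

MergeStep : (r : ℕ) → ∀ {n} → List (List (Edge n)) → List (List (Edge n)) → Set
MergeStep r P Q = Σ _ λ A → Σ _ λ B → Σ _ λ R →
  P ↭ (A ∷ B ∷ R) × Mergeable r A B × Q ↭ ((A ++ B) ∷ R)

IsM2 : (r : ℕ) → ∀ {n} → List (Edge n) → List (List (Edge n)) → Set
IsM2 r G P = Σ _ λ P₀ → IsM1 G P₀ × Star (MergeStep r) P₀ P × (∀ Q → ¬ MergeStep r P Q)

-- 2/(k-2), written with denominator suc (k ∸ 3) = k ∸ 2 (valid as k ≥ 4)
twoOver : ℕ → ℚ
twoOver k = + 2 / suc (k ∸ 3)

w : (r k : ℕ) → ∀ {n} → List (Edge n) → Fin n → Fin n → ℚ
w r k F x y =
  if ⌊ InC? r F x y 1 ⌋ then 1ℚ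
  else if ⌊ InC? r F x y 2 ⌋ then twoOver k
  else 0ℚ

wTotal : (r k : ℕ) → ∀ {n} → List (List (Edge n)) → Fin n → Fin n → ℚ
wTotal r k P x y =
  foldr _+ℚ_ 0ℚ (map (λ F → if ⌊ x ∈? V F ⌋ ∧ ⌊ y ∈? V F ⌋ then w r k F x y else 0ℚ) P)

{-# OPTIONS --safe #-}
module Submission where

-- Call a list S of edges tight (at the pair xy) if |{x,y} ∪ ⋃S| ≤ (r−2)|S| + 2, so that
-- i ∈ C_F(xy) says that F contains i distinct edges forming a tight list. By submodularity of
-- U ↦ |{x,y} ∪ U|, a concatenation of tight lists is tight; in particular two tight single edges
-- of size r share at least two vertices. The parts of M₁ are closed under this adjacency inside G,
-- and merging preserves closedness. Hence if some part F of M₂ has 1 ∈ C_F(xy), no other part has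
-- 1 in its C, nor 2 (the two parts would be 1|2-mergeable), and w(xy) ≤ 1. Otherwise w(xy) is at
-- most 2/(k−2) times the number m of parts with 2 ∈ C_F(xy). If m ≥ k/2, the tight pairs of k/2 of
-- these pairwise disjoint parts are k distinct edges spanning at most (r−2)k + 2 vertices, which
-- G_k-freeness forbids. So m ≤ k/2 − 1 and w(xy) ≤ (k/2 − 1) · 2/(k−2) = 1.

open import Defs
open import Data.Nat using (ℕ; zero; suc; _+_; _*_; _∸_; _≤_; s≤s)
open import Data.Nat.Properties
  using ( +-suc; n≤1+n; *-zeroʳ; ≤-reflexive; ≤-trans; ≰⇒>; +-mono-≤; +-monoˡ-≤; +-cancelˡ-≤; +-cancelʳ-≤
        ; *-monoˡ-≤; m≤n+m∸n; m∸n+n≡m; module ≤-Reasoning)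
open import Data.Nat.Solver using (module +-*-Solver)
import Data.Nat.Divisibility as Div using (_∣_; divides)
open import Data.Integer as ℤ using (+≤+)
import Data.Integer.Properties as ℤ
import Data.Integer.Solver as ℤ
open import Data.Rational using (ℚ; 0ℚ; 1ℚ; _/_; toℚᵘ) renaming (_+_ to _+ℚ_; _≤_ to _≤ℚ_)
open import Data.Rational.Base using (+-0-rawMonoid)
import Data.Rational.Properties as ℚ
open import Data.Rational.Unnormalised as ℚᵘ using (mkℚᵘ; *≡*; *≤*; _≃_)
import Data.Rational.Unnormalised.Properties as ℚᵘ
open import Algebra.Definitions.RawMonoid +-0-rawMonoid using () renaming (_×_ to _×ℚ_)
open import Data.Bool using (true; false; if_then_else_; _∧_)
import Data.Bool.Properties as Bool
open import Data.Fin using (Fin; zero; suc)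
open import Data.Vec using ([]; _∷_)
import Data.Vec.Properties as Vec
open import Data.Fin.Subset using (Subset; ⊥; ⁅_⁆; _∪_; _∩_; ∣_∣) renaming (_⊆_ to _⊆ˢ_; _∈_ to _∈ˢ_)
open import Data.Fin.Subset.Properties
  using ( ∪-identityˡ; ∪-identityʳ; ∪-assoc; ∩-comm; ∪-distribˡ-∩; ∪-isCommutativeMonoid; ∣⁅x⁆∣≡1
        ; p⊆q⇒∣p∣≤∣q∣; p⊆p∪q; q⊆p∪q; x∈p∪q⁻; _∈?_)
open import Data.List using (List; []; _∷_; _++_; concat; length; filter)
open import Data.List.Properties using (length-++; filter-accept; filter-reject; ++-assoc)
open import Data.List.Membership.Propositional using (_∈_; find)
open import Data.List.Membership.Propositional.Properties
  using (∈-++⁻; ∈-++⁺ˡ; ∈-++⁺ʳ; ∈-map⁻; ∈-map⁺; ∈-∃++; ∈-concat⁺′; ∈-concat⁻′; ∈-filter⁺; ∈-filter⁻)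
open import Data.List.Membership.Propositional.Properties.WithK using (unique∧set⇒bag)
import Data.List.Membership.DecPropositional as DecMembership
open import Data.List.Relation.Binary.Subset.Propositional using (_⊆_)
open import Data.List.Relation.Binary.Disjoint.Propositional using (Disjoint)
open import Data.List.Relation.Unary.Any as Any using (Any; here; there)
open import Data.List.Relation.Unary.All as All using (All; []; _∷_)
import Data.List.Relation.Unary.All.Properties as All
open import Data.List.Relation.Unary.AllPairs as AllPairs using (AllPairs; []; _∷_)
import Data.List.Relation.Unary.AllPairs.Properties as AllPairs
open import Data.List.Relation.Unary.Unique.Propositional using (Unique)
import Data.List.Relation.Unary.Unique.Propositional.Properties as Unique
open import Data.List.Relation.Binary.Permutation.Propositional
  using (_↭_; ↭-refl; ↭-prep; ↭-swap; ↭-trans; ↭-sym; ↭-isEquivalence; ↭-setoid; ↭⇒↭ₛ; ↭⇒↭ₛ′)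
open import Data.List.Relation.Binary.Permutation.Propositional.Properties
  using (All-resp-↭; ∈-resp-↭; ↭-length; shift; ++-isCommutativeMonoid)
import Data.List.Relation.Binary.Permutation.Setoid.Properties as Permutationₛ
open import Data.List.Relation.Binary.BagAndSetEquality using (∼bag⇒↭)
open import Data.Product as Product using (∃; _×_; _,_; proj₁; proj₂)
open import Data.Sum using (_⊎_; inj₁; inj₂)
open import Function using (_∘_; id; mk⇔)
open import Level using (0ℓ)
open import Relation.Nullary using (¬_; Dec; does; yes; no; contradiction)
open import Relation.Nullary.Decidable using (⌊_⌋; isYes≗does; dec-true; dec-false)
open import Relation.Unary using (Pred; Decidable)
open import Relation.Binary using (_Respects_; DecidableEquality)
open import Relation.Binary.PropositionalEquality
  using (_≡_; _≢_; refl; sym; trans; cong; cong₂; subst; subst₂; setoid; module ≡-Reasoning)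
open import Relation.Binary.Construct.Closure.ReflexiveTransitive as Star using (Star; ε; _◅_; _◅◅_)

-- Cardinalities of finite subsets

∣p∪q∣+∣p∩q∣≡∣p∣+∣q∣ : ∀ {n} (p q : Subset n) → ∣ p ∪ q ∣ + ∣ p ∩ q ∣ ≡ ∣ p ∣ + ∣ q ∣
∣p∪q∣+∣p∩q∣≡∣p∣+∣q∣ []          []          = refl
∣p∪q∣+∣p∩q∣≡∣p∣+∣q∣ (true  ∷ p) (true  ∷ q) = cong suc (begin
  ∣ p ∪ q ∣ + suc ∣ p ∩ q ∣    ≡⟨ +-suc ∣ p ∪ q ∣ ∣ p ∩ q ∣ ⟩
  suc (∣ p ∪ q ∣ + ∣ p ∩ q ∣)  ≡⟨ cong suc (∣p∪q∣+∣p∩q∣≡∣p∣+∣q∣ p q) ⟩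
  suc (∣ p ∣ + ∣ q ∣)          ≡⟨ +-suc ∣ p ∣ ∣ q ∣ ⟨
  ∣ p ∣ + suc ∣ q ∣            ∎)
  where open ≡-Reasoning
∣p∪q∣+∣p∩q∣≡∣p∣+∣q∣ (true  ∷ p) (false ∷ q) = cong suc (∣p∪q∣+∣p∩q∣≡∣p∣+∣q∣ p q)
∣p∪q∣+∣p∩q∣≡∣p∣+∣q∣ (false ∷ p) (true  ∷ q) =
  trans (cong suc (∣p∪q∣+∣p∩q∣≡∣p∣+∣q∣ p q)) (sym (+-suc ∣ p ∣ ∣ q ∣))
∣p∪q∣+∣p∩q∣≡∣p∣+∣q∣ (false ∷ p) (false ∷ q) = ∣p∪q∣+∣p∩q∣≡∣p∣+∣q∣ p q

∣⁅x⁆∪⁅y⁆∣≡2 : ∀ {n} {x y : Fin n} → x ≢ y → ∣ ⁅ x ⁆ ∪ ⁅ y ⁆ ∣ ≡ 2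
∣⁅x⁆∪⁅y⁆∣≡2 {x = zero}  {zero}  x≢y = contradiction refl x≢y
∣⁅x⁆∪⁅y⁆∣≡2 {x = zero}  {suc y} _   = cong suc (trans (cong ∣_∣ (∪-identityˡ ⁅ y ⁆)) (∣⁅x⁆∣≡1 y))
∣⁅x⁆∪⁅y⁆∣≡2 {x = suc x} {zero}  _   = cong suc (trans (cong ∣_∣ (∪-identityʳ ⁅ x ⁆)) (∣⁅x⁆∣≡1 x))
∣⁅x⁆∪⁅y⁆∣≡2 {x = suc x} {suc y} x≢y = ∣⁅x⁆∪⁅y⁆∣≡2 (x≢y ∘ cong suc)

∣p∪[q∪r]∣+∣p∣≤∣p∪q∣+∣p∪r∣ : ∀ {n} (p q r : Subset n) →
  ∣ p ∪ (q ∪ r) ∣ + ∣ p ∣ ≤ ∣ p ∪ q ∣ + ∣ p ∪ r ∣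
∣p∪[q∪r]∣+∣p∣≤∣p∪q∣+∣p∪r∣ p q r = begin
  ∣ p ∪ (q ∪ r) ∣ + ∣ p ∣                        ≤⟨ +-mono-≤ (p⊆q⇒∣p∣≤∣q∣ ⊆-join) (p⊆q⇒∣p∣≤∣q∣ ⊆-meet) ⟩
  ∣ (p ∪ q) ∪ (p ∪ r) ∣ + ∣ (p ∪ q) ∩ (p ∪ r) ∣  ≡⟨ ∣p∪q∣+∣p∩q∣≡∣p∣+∣q∣ (p ∪ q) (p ∪ r) ⟩
  ∣ p ∪ q ∣ + ∣ p ∪ r ∣                          ∎
  where
  open ≤-Reasoning
  ⊆-join : p ∪ (q ∪ r) ⊆ˢ (p ∪ q) ∪ (p ∪ r)
  ⊆-join z∈ with x∈p∪q⁻ p (q ∪ r) z∈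
  ... | inj₁ z∈p = p⊆p∪q (p ∪ r) (p⊆p∪q q z∈p)
  ... | inj₂ z∈q∪r with x∈p∪q⁻ q r z∈q∪r
  ...   | inj₁ z∈q = p⊆p∪q (p ∪ r) (q⊆p∪q p q z∈q)
  ...   | inj₂ z∈r = q⊆p∪q (p ∪ q) (p ∪ r) (q⊆p∪q p r z∈r)
  ⊆-meet : p ⊆ˢ (p ∪ q) ∩ (p ∪ r)
  ⊆-meet = subst (p ⊆ˢ_) (∪-distribˡ-∩ p q r) (p⊆p∪q (q ∩ r))

Unique-resp-↭ : ∀ {A : Set} → Unique {A = A} Respects _↭_
Unique-resp-↭ {A} = Permutationₛ.Unique-resp-↭ (setoid A) ∘ ↭⇒↭ₛ

Unique-++⁻ : ∀ {A : Set} (xs : List A) {ys} →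
  Unique (xs ++ ys) → Unique xs × Unique ys × Disjoint xs ys
Unique-++⁻ []       u          = [] , u , λ ()
Unique-++⁻ (x ∷ xs) {ys} (x∉ ∷ u) with Unique-++⁻ xs u
... | uxs , uys , xs#ys = All.++⁻ˡ xs x∉ ∷ uxs , uys , x∷xs#ys
  where
  x∷xs#ys : Disjoint (x ∷ xs) ys
  x∷xs#ys (here refl , v∈ys) = All.lookup (All.++⁻ʳ xs x∉) v∈ys refl
  x∷xs#ys (there v∈xs , v∈ys) = xs#ys (v∈xs , v∈ys)

Unique-concat⁻ : ∀ {A : Set} (xss : List (List A)) →
  Unique (concat xss) → All Unique xss × AllPairs Disjoint xss
Unique-concat⁻ []         _ = [] , []
Unique-concat⁻ (xs ∷ xss) u with Unique-++⁻ xs u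
... | uxs , urest , xs#rest with Unique-concat⁻ xss urest
...   | us , ds = uxs ∷ us , All.tabulate xs#ys ∷ ds
  where
  xs#ys : ∀ {ys} → ys ∈ xss → Disjoint xs ys
  xs#ys ys∈ (v∈xs , v∈ys) = xs#rest (v∈xs , ∈-concat⁺′ v∈ys ys∈)

concat-filter-⊆ : ∀ {A : Set} {P : Pred (List A) 0ℓ} (P? : Decidable P) xss →
  concat (filter P? xss) ⊆ concat xss
concat-filter-⊆ P? xss v∈ with ∈-concat⁻′ (filter P? xss) v∈
... | xs , v∈xs , xs∈ = ∈-concat⁺′ v∈xs (proj₁ (∈-filter⁻ P? {xs = xss} xs∈))

concat-↭ : ∀ {A : Set} {xss yss : List (List A)} → xss ↭ yss → concat xss ↭ concat yss
concat-↭ {A} = Permutationₛ.foldr-commMonoid (↭-setoid {A = A}) ++-isCommutativeMonoid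
             ∘ ↭⇒↭ₛ′ ↭-isEquivalence

V-↭ : ∀ {n} {S T : List (Edge n)} → S ↭ T → V S ≡ V T
V-↭ {n} = Permutationₛ.foldr-commMonoid (setoid (Subset n)) (∪-isCommutativeMonoid n) ∘ ↭⇒↭ₛ

V-++ : ∀ {n} (S T : List (Edge n)) → V (S ++ T) ≡ V S ∪ V T
V-++ []      T = sym (∪-identityˡ (V T))
V-++ (e ∷ S) T = trans (cong (e ∪_) (V-++ S T)) (sym (∪-assoc e (V S) (V T)))

↭-splits⇒AllPairs : ∀ {A : Set} {R : A → A → Set} (xs : List A) →
  (∀ {a b zs} → xs ↭ a ∷ b ∷ zs → R a b) → AllPairs R xs
↭-splits⇒AllPairs []                 _     = []
↭-splits⇒AllPairs {R = R} (x ∷ xs) split = All.tabulate head-pairs ∷ ↭-splits⇒AllPairs xs tail-split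
  where
  head-pairs : ∀ {b} → b ∈ xs → R x b
  head-pairs b∈xs with ∈-∃++ b∈xs
  ... | ys , zs , refl = split (↭-prep x (shift _ ys zs))
  tail-split : ∀ {a b zs} → xs ↭ a ∷ b ∷ zs → R a b
  tail-split {a} {b} xs↭ =
    split (↭-trans (↭-prep x xs↭) (↭-trans (↭-swap x a ↭-refl) (↭-prep a (↭-swap x b ↭-refl))))

∈-subs⁻ : ∀ {A : Set} (a : A) as {S} →
  S ∈ subs (a ∷ as) → S ∈ subs as ⊎ ∃ λ S′ → S ≡ a ∷ S′ × S′ ∈ subs as
∈-subs⁻ a as S∈ with ∈-++⁻ (subs as) S∈
... | inj₁ S∈subs = inj₁ S∈subs
... | inj₂ S∈map with ∈-map⁻ (a ∷_) S∈map
...   | S′ , S′∈ , refl = inj₂ (S′ , refl , S′∈)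

subs-⊆ : ∀ {A : Set} (as : List A) {S} → S ∈ subs as → S ⊆ as
subs-⊆ []       (here refl) ()
subs-⊆ (a ∷ as) S∈ v∈S with ∈-subs⁻ a as S∈
... | inj₁ S∈′ = there (subs-⊆ as S∈′ v∈S)
... | inj₂ (S′ , refl , S′∈) with v∈S
...   | here refl  = here refl
...   | there v∈S′ = there (subs-⊆ as S′∈ v∈S′)

subs-Unique : ∀ {A : Set} {as S : List A} → Unique as → S ∈ subs as → Unique S
subs-Unique {as = []}     []         (here refl) = []
subs-Unique {as = a ∷ as} (a∉ ∷ uas) S∈ with ∈-subs⁻ a as S∈
... | inj₁ S∈′               = subs-Unique uas S∈′
... | inj₂ (S′ , refl , S′∈) = All.anti-mono (subs-⊆ as S′∈) a∉ ∷ subs-Unique uas S′∈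

filter∈subs : ∀ {A : Set} {P : Pred A 0ℓ} (P? : Decidable P) (as : List A) → filter P? as ∈ subs as
filter∈subs P? []       = here refl
filter∈subs P? (a ∷ as) with does (P? a)
... | true  = ∈-++⁺ʳ (subs as) (∈-map⁺ (a ∷_) (filter∈subs P? as))
... | false = ∈-++⁺ˡ (filter∈subs P? as)

⊆⇒subs-↭ : ∀ {A : Set} → DecidableEquality A → ∀ {as bs : List A} →
  Unique as → Unique bs → bs ⊆ as → ∃ λ S → S ∈ subs as × S ↭ bs
⊆⇒subs-↭ _≟_ {as} {bs} uas ubs bs⊆as = filter (_∈ₗ? bs) as , filter∈subs (_∈ₗ? bs) as , filter↭bs
  where
  open DecMembership _≟_ using () renaming (_∈?_ to _∈ₗ?_)
  filter↭bs : filter (_∈ₗ? bs) as ↭ bs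
  filter↭bs = ∼bag⇒↭ (unique∧set⇒bag (Unique.filter⁺ (_∈ₗ? bs) uas) ubs
    (mk⇔ (proj₂ ∘ ∈-filter⁻ (_∈ₗ? bs) {xs = as}) (λ v∈bs → ∈-filter⁺ (_∈ₗ? bs) (bs⊆as v∈bs) v∈bs)))

-- Partitions into parts closed under 2-intersection

module _ {n : ℕ} (G : List (Edge n)) where

  Closed : List (Edge n) → Set
  Closed A = ∀ {e f} → e ∈ A → f ∈ G → 2 ≤ ∣ e ∩ f ∣ → f ∈ A

  ClosedPartition : List (List (Edge n)) → Set
  ClosedPartition P = concat P ↭ G × All Closed P

  maximalConnected⇒Closed : ∀ {A} → A ⊆ G → MaximalConnected G A → Closed A
  maximalConnected⇒Closed {A} A⊆G (connected , maximal) {e} {f} e∈A f∈G 2≤e∩f =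
    maximal (f ∷ A) f∷A⊆G connected′ (λ _ → there) f (here refl)
    where
    f∷A⊆G : ∀ d → d ∈ f ∷ A → d ∈ G
    f∷A⊆G d (here refl) = f∈G
    f∷A⊆G d (there d∈A) = A⊆G d∈A
    widen : ∀ {X Y} → Star (Adj A) X Y → Star (Adj (f ∷ A)) X Y
    widen = Star.map (λ (X∈ , Y∈ , 2≤X∩Y) → there X∈ , there Y∈ , 2≤X∩Y)
    connected′ : Connected (f ∷ A)
    connected′ X Y (here refl) (here refl) = ε
    connected′ X Y (here refl) (there Y∈A) =
      (here refl , there e∈A , subst (2 ≤_) (cong ∣_∣ (∩-comm e f)) 2≤e∩f) ◅ widen (connected e Y e∈A Y∈A)
    connected′ X Y (there X∈A) (here refl) =
      widen (connected X e X∈A e∈A) ◅◅ ((there e∈A , here refl , 2≤e∩f) ◅ ε)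
    connected′ X Y (there X∈A) (there Y∈A) = widen (connected X Y X∈A Y∈A)

  Closed-++ : ∀ {A B} → Closed A → Closed B → Closed (A ++ B)
  Closed-++ {A} closedA closedB e∈ f∈G 2≤e∩f with ∈-++⁻ A e∈
  ... | inj₁ e∈A = ∈-++⁺ˡ (closedA e∈A f∈G 2≤e∩f)
  ... | inj₂ e∈B = ∈-++⁺ʳ A (closedB e∈B f∈G 2≤e∩f)

  IsM1⇒ClosedPartition : ∀ {P} → IsM1 G P → ClosedPartition P
  IsM1⇒ClosedPartition (P↭G , parts) = P↭G , All.tabulate λ A∈P →
    maximalConnected⇒Closed (λ e∈A → ∈-resp-↭ P↭G (∈-concat⁺′ e∈A A∈P)) (proj₂ (parts _ A∈P))

  merge-preserves-ClosedPartition : ∀ r {P Q} → MergeStep r P Q → ClosedPartition P → ClosedPartition Q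
  merge-preserves-ClosedPartition r {Q = Q} (A , B , R , P↭ , _ , Q↭) (P↭G , closedP)
    with All-resp-↭ P↭ closedP
  ... | closedA ∷ closedB ∷ closedR =
    concatQ↭G , All-resp-↭ (↭-sym Q↭) (Closed-++ closedA closedB ∷ closedR)
    where
    concatQ↭G : concat Q ↭ G
    concatQ↭G = ↭-trans (concat-↭ Q↭)
      (subst (_↭ G) (sym (++-assoc A B (concat R))) (↭-trans (concat-↭ (↭-sym P↭)) P↭G))

  merges-preserve-ClosedPartition : ∀ r {P Q} → Star (MergeStep r) P Q → ClosedPartition P → ClosedPartition Q
  merges-preserve-ClosedPartition r ε              = id
  merges-preserve-ClosedPartition r (step ◅ steps) =
    merges-preserve-ClosedPartition r steps ∘ merge-preserves-ClosedPartition r step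

+-mkℚᵘ-sameDenominator : ∀ a b d → mkℚᵘ a d ℚᵘ.+ mkℚᵘ b d ≃ mkℚᵘ (a ℤ.+ b) d
+-mkℚᵘ-sameDenominator a b d =
  *≡* (solve 3 (λ a b d → (a :* d :+ b :* d) :* d := (a :+ b) :* (d :* d)) refl a b (ℤ.+ suc d))
  where open ℤ.+-*-Solver

toℚᵘ-×-/ : ∀ m a d → toℚᵘ (m ×ℚ (ℤ.+ a / suc d)) ≃ mkℚᵘ (ℤ.+ (m * a)) d
toℚᵘ-×-/ zero    a d = *≡* refl
toℚᵘ-×-/ (suc m) a d = begin
  toℚᵘ (q +ℚ m ×ℚ q)               ≈⟨ ℚ.toℚᵘ-homo-+ q (m ×ℚ q) ⟩
  toℚᵘ q ℚᵘ.+ toℚᵘ (m ×ℚ q)        ≈⟨ ℚᵘ.+-cong (ℚ.toℚᵘ-fromℚᵘ (mkℚᵘ (ℤ.+ a) d)) (toℚᵘ-×-/ m a d) ⟩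
  mkℚᵘ (ℤ.+ a) d ℚᵘ.+ mkℚᵘ (ℤ.+ (m * a)) d  ≈⟨ +-mkℚᵘ-sameDenominator (ℤ.+ a) (ℤ.+ (m * a)) d ⟩
  mkℚᵘ (ℤ.+ (a + m * a)) d        ∎
  where
  open ℚᵘ.≃-Reasoning
  q : ℚ
  q = ℤ.+ a / suc d

×-/-≤1 : ∀ m a d → m * a ≤ suc d → m ×ℚ (ℤ.+ a / suc d) ≤ℚ 1ℚ
×-/-≤1 m a d m*a≤1+d = ℚ.toℚᵘ-cancel-≤ (ℚᵘ.≤-respˡ-≃ (ℚᵘ.≃-sym (toℚᵘ-×-/ m a d)) (*≤* cross-multiplied))
  where
  cross-multiplied : ℤ.+ (m * a) ℤ.* ℤ.+ 1 ℤ.≤ ℤ.+ 1 ℤ.* ℤ.+ suc d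
  cross-multiplied =
    subst₂ ℤ._≤_ (sym (ℤ.*-identityʳ (ℤ.+ (m * a)))) (sym (ℤ.*-identityˡ (ℤ.+ suc d))) (+≤+ m*a≤1+d)

×twoOver≤1 : ∀ {k} m → suc m * 2 ≤ k → m ×ℚ twoOver k ≤ℚ 1ℚ
×twoOver≤1 {suc (suc k)} m (s≤s (s≤s m*2≤k)) = ×-/-≤1 m 2 (k ∸ 1) (≤-trans m*2≤k (m≤n+m∸n k 1))

0≤twoOver : ∀ k → 0ℚ ≤ℚ twoOver k
0≤twoOver k = ℚ.nonNegative⁻¹ (twoOver k) {{ℚ.normalize-nonNeg 2 (suc (k ∸ 3))}}

⌊⌋-true : ∀ {A : Set} (a? : Dec A) → A → ⌊ a? ⌋ ≡ true
⌊⌋-true a? a = trans (isYes≗does a?) (dec-true a? a)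

⌊⌋-false : ∀ {A : Set} (a? : Dec A) → ¬ A → ⌊ a? ⌋ ≡ false
⌊⌋-false a? ¬a = trans (isYes≗does a?) (dec-false a? ¬a)

if-then-else-0-≤ : ∀ b {q} → 0ℚ ≤ℚ q → (if b then q else 0ℚ) ≤ℚ q
if-then-else-0-≤ true  _   = ℚ.≤-refl
if-then-else-0-≤ false 0≤q = 0≤q

-- Tight edge lists at a pair xy

module AtPair (r : ℕ) {n : ℕ} {x y : Fin n} (x≢y : x ≢ y) where

  XY : Subset n
  XY = ⁅ x ⁆ ∪ ⁅ y ⁆

  One Two Silent : List (Edge n) → Set
  One F = InC r F x y 1
  Two F = InC r F x y 2
  Silent F = ¬ One F × ¬ Two F

  Two? : Decidable Two
  Two? F = InC? r F x y 2

  Tight : List (Edge n) → Set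
  Tight S = ∣ XY ∪ V S ∣ ≤ (r ∸ 2) * length S + 2

  InC⇒Tight : ∀ F {i} → InC r F x y i → ∃ λ S → S ∈ subs F × length S ≡ i × Tight S
  InC⇒Tight F c with find c
  ... | S , S∈ , refl , tight = S , S∈ , refl , tight

  One⇒tight-edge : ∀ F → One F → ∃ λ e → e ∈ F × Tight (e ∷ [])
  One⇒tight-edge F oneF with InC⇒Tight F oneF
  ... | e ∷ [] , S∈ , _ , tight = e , subs-⊆ F S∈ (here refl) , tight

  Tight-[] : Tight []
  Tight-[] = ≤-reflexive (begin
    ∣ XY ∪ ⊥ ∣        ≡⟨ cong ∣_∣ (∪-identityʳ XY) ⟩
    ∣ XY ∣            ≡⟨ ∣⁅x⁆∪⁅y⁆∣≡2 x≢y ⟩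
    2                 ≡⟨ cong (_+ 2) (*-zeroʳ (r ∸ 2)) ⟨
    (r ∸ 2) * 0 + 2   ∎)
    where open ≡-Reasoning

  Tight-++ : ∀ S T → Tight S → Tight T → Tight (S ++ T)
  Tight-++ S T tightS tightT = +-cancelʳ-≤ 2 _ _ (begin
    ∣ XY ∪ V (S ++ T) ∣ + 2                  ≡⟨ cong₂ (λ U m → ∣ XY ∪ U ∣ + m) (V-++ S T) (sym ∣XY∣≡2) ⟩
    ∣ XY ∪ (V S ∪ V T) ∣ + ∣ XY ∣             ≤⟨ ∣p∪[q∪r]∣+∣p∣≤∣p∪q∣+∣p∪r∣ XY (V S) (V T) ⟩
    ∣ XY ∪ V S ∣ + ∣ XY ∪ V T ∣               ≤⟨ +-mono-≤ tightS tightT ⟩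
    (s * length S + 2) + (s * length T + 2)   ≡⟨ regroup s (length S) (length T) ⟩
    s * (length S + length T) + 2 + 2         ≡⟨ cong (λ m → s * m + 2 + 2) (length-++ S) ⟨
    s * length (S ++ T) + 2 + 2               ∎)
    where
    open ≤-Reasoning
    open +-*-Solver
    ∣XY∣≡2 : ∣ XY ∣ ≡ 2
    ∣XY∣≡2 = ∣⁅x⁆∪⁅y⁆∣≡2 x≢y
    s : ℕ
    s = r ∸ 2
    regroup : ∀ s a b → (s * a + 2) + (s * b + 2) ≡ s * (a + b) + 2 + 2
    regroup = solve 3 (λ s a b → (s :* a :+ con 2) :+ (s :* b :+ con 2) := s :* (a :+ b) :+ con 2 :+ con 2) refl

  tight-edges-meet : 2 ≤ r → ∀ {e f} → ∣ e ∣ ≡ r → ∣ f ∣ ≡ r →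
    Tight (e ∷ []) → Tight (f ∷ []) → 2 ≤ ∣ e ∩ f ∣
  tight-edges-meet 2≤r {e} {f} ∣e∣≡r ∣f∣≡r tight-e tight-f = +-cancelˡ-≤ (s * 2 + 2) 2 ∣ e ∩ f ∣ (begin
    s * 2 + 2 + 2          ≡⟨ regroup s ⟩
    (s + 2) + (s + 2)      ≡⟨ cong₂ _+_ (m∸n+n≡m 2≤r) (m∸n+n≡m 2≤r) ⟩
    r + r                  ≡⟨ cong₂ _+_ ∣e∣≡r ∣f∣≡r ⟨
    ∣ e ∣ + ∣ f ∣           ≡⟨ ∣p∪q∣+∣p∩q∣≡∣p∣+∣q∣ e f ⟨
    ∣ e ∪ f ∣ + ∣ e ∩ f ∣   ≤⟨ +-monoˡ-≤ ∣ e ∩ f ∣ ∣e∪f∣≤ ⟩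
    s * 2 + 2 + ∣ e ∩ f ∣   ∎)
    where
    open ≤-Reasoning
    open +-*-Solver
    s : ℕ
    s = r ∸ 2
    regroup : ∀ s → s * 2 + 2 + 2 ≡ (s + 2) + (s + 2)
    regroup = solve 1 (λ s → s :* con 2 :+ con 2 :+ con 2 := (s :+ con 2) :+ (s :+ con 2)) refl
    e∪f⊆ : e ∪ f ⊆ˢ XY ∪ V (e ∷ f ∷ [])
    e∪f⊆ = subst (_⊆ˢ XY ∪ V (e ∷ f ∷ [])) (cong (e ∪_) (∪-identityʳ f)) (q⊆p∪q XY _)
    ∣e∪f∣≤ : ∣ e ∪ f ∣ ≤ s * 2 + 2
    ∣e∪f∣≤ = ≤-trans (p⊆q⇒∣p∣≤∣q∣ e∪f⊆) (Tight-++ (e ∷ []) (f ∷ []) tight-e tight-f)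

  Exclusive : List (Edge n) → List (Edge n) → Set
  Exclusive A B = (One A → Silent B) × (One B → Silent A)

  module _ (2≤r : 2 ≤ r) {G : List (Edge n)} (uniform : All (λ e → ∣ e ∣ ≡ r) G) where

    One-excludes-One : ∀ {A B} → Closed G A → A ⊆ G → B ⊆ G → Disjoint A B → One A → ¬ One B
    One-excludes-One {A} {B} closedA A⊆G B⊆G A#B oneA oneB
      with One⇒tight-edge A oneA | One⇒tight-edge B oneB
    ... | e , e∈A , tight-e | f , f∈B , tight-f = A#B (f∈A , f∈B)
      where
      2≤e∩f : 2 ≤ ∣ e ∩ f ∣
      2≤e∩f = tight-edges-meet 2≤r (All.lookup uniform (A⊆G e∈A)) (All.lookup uniform (B⊆G f∈B)) tight-e tight-f
      f∈A : f ∈ A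
      f∈A = closedA e∈A (B⊆G f∈B) 2≤e∩f

    unmergeable⇒Exclusive : ∀ {A B} → Closed G A → Closed G B → A ⊆ G → B ⊆ G → Disjoint A B →
      ¬ Mergeable r A B → Exclusive A B
    unmergeable⇒Exclusive closedA closedB A⊆G B⊆G A#B ¬mergeable =
        (λ oneA → One-excludes-One closedA A⊆G B⊆G A#B oneA
                , λ twoB → ¬mergeable (x , y , x≢y , inj₁ (oneA , twoB)))
      , (λ oneB → One-excludes-One closedB B⊆G A⊆G (A#B ∘ Product.swap) oneB
                , λ twoA → ¬mergeable (x , y , x≢y , inj₂ (twoA , oneB)))

    parts-Exclusive : Unique G → ∀ {P} → ClosedPartition G P → (∀ Q → ¬ MergeStep r P Q) →
      AllPairs Exclusive P
    parts-Exclusive uniqueG {P} (P↭G , closedP) maximal = ↭-splits⇒AllPairs P split-Exclusive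
      where
      split-Exclusive : ∀ {A B R} → P ↭ A ∷ B ∷ R → Exclusive A B
      split-Exclusive {A} {B} {R} P↭ with All-resp-↭ P↭ closedP
      ... | closedA ∷ closedB ∷ _ =
        unmergeable⇒Exclusive closedA closedB (⊆G ∘ ∈-++⁺ˡ) (⊆G ∘ ∈-++⁺ʳ A ∘ ∈-++⁺ˡ) A#B
          (λ mergeable → maximal _ (A , B , R , P↭ , mergeable , ↭-refl))
        where
        split↭G : concat (A ∷ B ∷ R) ↭ G
        split↭G = ↭-trans (concat-↭ (↭-sym P↭)) P↭G
        ⊆G : concat (A ∷ B ∷ R) ⊆ G
        ⊆G = ∈-resp-↭ split↭G
        A#B∪R : Disjoint A (B ++ concat R)
        A#B∪R = proj₂ (proj₂ (Unique-++⁻ A (Unique-resp-↭ (↭-sym split↭G) uniqueG)))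
        A#B : Disjoint A B
        A#B (v∈A , v∈B) = A#B∪R (v∈A , ∈-++⁺ˡ v∈B)

  Two-parts⇒tight-edges : ∀ Q → All Two Q → All Unique Q → AllPairs Disjoint Q → ∀ j → j ≤ length Q →
    ∃ λ L → Unique L × L ⊆ concat Q × length L ≡ j * 2 × Tight L
  Two-parts⇒tight-edges _ _ _ _ zero _ = [] , [] , (λ ()) , refl , Tight-[]
  Two-parts⇒tight-edges (A ∷ Q) (twoA ∷ twoQ) (uA ∷ uQ) (A#Q ∷ dQ) (suc j) (s≤s j≤∣Q∣)
    with InC⇒Tight A twoA | Two-parts⇒tight-edges Q twoQ uQ dQ j j≤∣Q∣
  ... | S , S∈ , ∣S∣≡2 , tightS | L , uL , L⊆Q , ∣L∣≡2j , tightL =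
    S ++ L , Unique.++⁺ (subs-Unique uA S∈) uL S#L , S++L⊆ , trans (length-++ S) (cong₂ _+_ ∣S∣≡2 ∣L∣≡2j) ,
    Tight-++ S L tightS tightL
    where
    S#L : Disjoint S L
    S#L (v∈S , v∈L) with ∈-concat⁻′ Q (L⊆Q v∈L)
    ... | B , v∈B , B∈Q = All.lookup A#Q B∈Q (subs-⊆ A S∈ v∈S , v∈B)
    S++L⊆ : S ++ L ⊆ A ++ concat Q
    S++L⊆ v∈ with ∈-++⁻ S v∈
    ... | inj₁ v∈S = ∈-++⁺ˡ (subs-⊆ A S∈ v∈S)
    ... | inj₂ v∈L = ∈-++⁺ʳ A (L⊆Q v∈L)

  GFree⇒¬Tight : ∀ {k G} → GFree r k G → Unique G → ∀ {L} → Unique L → L ⊆ G → length L ≡ k → ¬ Tight L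
  GFree⇒¬Tight {k} free uniqueG {L} uL L⊆G ∣L∣≡k tightL
    with ⊆⇒subs-↭ (Vec.≡-dec Bool._≟_) uniqueG uL L⊆G
  ... | H , H∈ , H↭L = proj₁ (free H H∈) (trans (↭-length H↭L) ∣L∣≡k , ∣VH∣≤)
    where
    open ≤-Reasoning
    ∣VH∣≤ : ∣ V H ∣ ≤ (r ∸ 2) * k + 2
    ∣VH∣≤ = begin
      ∣ V H ∣                  ≡⟨ cong ∣_∣ (V-↭ H↭L) ⟩
      ∣ V L ∣                  ≤⟨ p⊆q⇒∣p∣≤∣q∣ (q⊆p∪q XY (V L)) ⟩
      ∣ XY ∪ V L ∣             ≤⟨ tightL ⟩
      (r ∸ 2) * length L + 2   ≡⟨ cong (λ m → (r ∸ 2) * m + 2) ∣L∣≡k ⟩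
      (r ∸ 2) * k + 2          ∎

  Two-parts-bound : ∀ {k G} P → 2 Div.∣ k → GFree r k G → Unique G → concat P ↭ G →
    suc (length (filter Two? P)) * 2 ≤ k
  Two-parts-bound P (Div.divides t refl) free uniqueG P↭G = *-monoˡ-≤ 2 (≰⇒> many⇒tight)
    where
    many⇒tight : ¬ t ≤ length (filter Two? P)
    many⇒tight t≤ with Unique-concat⁻ P (Unique-resp-↭ (↭-sym P↭G) uniqueG)
    ... | uP , dP
      with Two-parts⇒tight-edges (filter Two? P) (All.all-filter Two? P) (All.filter⁺ Two? uP)
             (AllPairs.filter⁺ Two? dP) t t≤
    ... | L , uL , L⊆ , ∣L∣≡t*2 , tightL =
      GFree⇒¬Tight free uniqueG uL (∈-resp-↭ P↭G ∘ concat-filter-⊆ Two? P ∘ L⊆) ∣L∣≡t*2 tightL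

  module _ (k : ℕ) where

    -- wTotal r k (F ∷ P) x y reduces to contribution F +ℚ wTotal r k P x y.
    contribution : List (Edge n) → ℚ
    contribution F = if ⌊ x ∈? V F ⌋ ∧ ⌊ y ∈? V F ⌋ then w r k F x y else 0ℚ

    w-One : ∀ F → One F → w r k F x y ≡ 1ℚ
    w-One F oneF = Bool.if-cong (⌊⌋-true (InC? r F x y 1) oneF)

    w-Two : ∀ F → ¬ One F → Two F → w r k F x y ≡ twoOver k
    w-Two F ¬oneF twoF =
      trans (Bool.if-cong (⌊⌋-false (InC? r F x y 1) ¬oneF)) (Bool.if-cong (⌊⌋-true (InC? r F x y 2) twoF))

    w-Silent : ∀ F → Silent F → w r k F x y ≡ 0ℚ
    w-Silent F (¬oneF , ¬twoF) =
      trans (Bool.if-cong (⌊⌋-false (InC? r F x y 1) ¬oneF)) (Bool.if-cong (⌊⌋-false (InC? r F x y 2) ¬twoF))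

    contribution-≤ : ∀ F {q} → w r k F x y ≡ q → 0ℚ ≤ℚ q → contribution F ≤ℚ q
    contribution-≤ F refl = if-then-else-0-≤ (⌊ x ∈? V F ⌋ ∧ ⌊ y ∈? V F ⌋)

    contribution-Silent : ∀ F → Silent F → contribution F ≡ 0ℚ
    contribution-Silent F silentF =
      trans (Bool.if-cong-then (⌊ x ∈? V F ⌋ ∧ ⌊ y ∈? V F ⌋) (w-Silent F silentF)) (Bool.if-eta _)

    wTotal-Silent : ∀ P → All Silent P → wTotal r k P x y ≡ 0ℚ
    wTotal-Silent []      []                  = refl
    wTotal-Silent (F ∷ P) (silentF ∷ silentP) =
      trans (cong₂ _+ℚ_ (contribution-Silent F silentF) (wTotal-Silent P silentP)) (ℚ.+-identityˡ 0ℚ)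

    wTotal-One : ∀ P → AllPairs Exclusive P → Any One P → wTotal r k P x y ≤ℚ 1ℚ
    wTotal-One (F ∷ P) (exclF ∷ _) (here oneF) = begin
      contribution F +ℚ wTotal r k P x y  ≡⟨ cong (contribution F +ℚ_) (wTotal-Silent P silentP) ⟩
      contribution F +ℚ 0ℚ                ≡⟨ ℚ.+-identityʳ (contribution F) ⟩
      contribution F                      ≤⟨ contribution-≤ F (w-One F oneF) (ℚ.nonNegative⁻¹ 1ℚ) ⟩
      1ℚ                                  ∎
      where
      open ℚ.≤-Reasoning
      silentP : All Silent P
      silentP = All.map (λ excl → proj₁ excl oneF) exclF
    wTotal-One (F ∷ P) (exclF ∷ exclP) (there oneP) = begin
      contribution F +ℚ wTotal r k P x y  ≡⟨ cong (_+ℚ wTotal r k P x y) (contribution-Silent F silentF) ⟩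
      0ℚ +ℚ wTotal r k P x y              ≡⟨ ℚ.+-identityˡ (wTotal r k P x y) ⟩
      wTotal r k P x y                    ≤⟨ wTotal-One P exclP oneP ⟩
      1ℚ                                  ∎
      where
      open ℚ.≤-Reasoning
      silentF : Silent F
      silentF = let excl , oneB = All.lookupAny exclF oneP in proj₂ excl oneB

    wTotal-¬One : ∀ P → All (¬_ ∘ One) P → wTotal r k P x y ≤ℚ length (filter Two? P) ×ℚ twoOver k
    wTotal-¬One []      []              = ℚ.≤-refl
    wTotal-¬One (F ∷ P) (¬oneF ∷ ¬oneP) = by-Two? (Two? F)
      where
      open ℚ.≤-Reasoning
      c : ℚ
      c = twoOver k
      by-Two? : Dec (Two F) → wTotal r k (F ∷ P) x y ≤ℚ length (filter Two? (F ∷ P)) ×ℚ c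
      by-Two? (yes twoF) = begin
        contribution F +ℚ wTotal r k P x y  ≤⟨ ℚ.+-mono-≤ (contribution-≤ F (w-Two F ¬oneF twoF) (0≤twoOver k))
                                                           (wTotal-¬One P ¬oneP) ⟩
        c +ℚ length (filter Two? P) ×ℚ c    ≡⟨ cong (λ Q → length Q ×ℚ c) (filter-accept Two? {F} {P} twoF) ⟨
        length (filter Two? (F ∷ P)) ×ℚ c   ∎
      by-Two? (no ¬twoF) = begin
        contribution F +ℚ wTotal r k P x y  ≡⟨ cong (_+ℚ wTotal r k P x y) (contribution-Silent F (¬oneF , ¬twoF)) ⟩
        0ℚ +ℚ wTotal r k P x y              ≡⟨ ℚ.+-identityˡ (wTotal r k P x y) ⟩
        wTotal r k P x y                    ≤⟨ wTotal-¬One P ¬oneP ⟩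
        length (filter Two? P) ×ℚ c         ≡⟨ cong (λ Q → length Q ×ℚ c) (filter-reject Two? {F} {P} ¬twoF) ⟨
        length (filter Two? (F ∷ P)) ×ℚ c   ∎

open import Data.Nat.Divisibility using (_∣_)

lemma3p11 : (r k n : ℕ) → 3 ≤ r → 4 ≤ k → 2 ∣ k →
    (G : List (Edge n)) → IsRGraph r n G → GFree r k G →
    (P : List (List (Edge n))) → IsM2 r G P →
    (x y : Fin n) → x ≢ y → x ∈ˢ V G → y ∈ˢ V G →
    wTotal r k P x y ≤ℚ 1ℚ
lemma3p11 r k n 3≤r _ 2∣k G (uniform , uniqueG) free P (_ , isM1 , merges , maximal) x y x≢y _ _ =
  bound (Any.any? (λ F → InC? r F x y 1) P)
  where
  open AtPair r x≢y
  partition : ClosedPartition G P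
  partition = merges-preserve-ClosedPartition G r merges (IsM1⇒ClosedPartition G isM1)
  bound : Dec (Any One P) → wTotal r k P x y ≤ℚ 1ℚ
  bound (yes someOne) =
    wTotal-One k P (parts-Exclusive (≤-trans (n≤1+n 2) 3≤r) uniform uniqueG partition maximal) someOne
  bound (no noOne) = ℚ.≤-trans (wTotal-¬One k P (All.¬Any⇒All¬ P noOne))
    (×twoOver≤1 (length (filter Two? P)) (Two-parts-bound P 2∣k free uniqueG (proj₁ partition)))
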